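{- Let $t\geq 3$ be an integer, let $M$ be a matroid and let $v\in E(M)$. If $M_v$ contains $PG(t-2,2)$, then $M$ contains $PG(t-1,2)$.
   Context: A matroid $M$ means a simple binary matroid, represented by an integer $r(M)\geq 0$ (its rank) and a set $E(M)\subseteq \mathbb{F}_2^{r(M)}\setminus\{0\}$ that spans $\mathbb{F}_2^{r(M)}$. For $v\in\mathbb{F}_2^{r(M)}$, $M_v$ is defined by $r(M_v)=r(M)$ and $E(M_v)=\{x: x\in E(M)\text{ and }x+v\in E(M)\}$. A matroid (or such an object) $M$ contains a matroid $N$ if there is an injective linear map $\iota:\mathbb{F}_2^{r(N)}\to\mathbb{F}_2^{r(M)}$ with $\iota(E(N))\subseteq E(M)$. The projective geometry $PG(s-1,2)$ is the matroid of rank $s$ with edge set $\mathbb{F}_2^s\setminus\{0\}$. -}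

module Defs where

open import Data.Nat using (ℕ)
open import Data.Bool using (Bool; true; false; _xor_)
open import Data.Vec using (Vec; replicate; zipWith)
open import Data.List using (List; foldr)
open import Data.List.Relation.Unary.All using (All)
open import Data.Product using (Σ; ∃; _×_; _,_)
open import Relation.Binary.PropositionalEquality using (_≡_)
open import Relation.Nullary using (¬_)
open import Function.Definitions using (Injective)
open import Level using (0ℓ) renaming (suc to lsuc)

F2^ : ℕ → Set
F2^ r = Vec Bool r

0v : ∀ {r} → F2^ r
0v {r} = replicate r false

_⊕_ : ∀ {r} → F2^ r → F2^ r → F2^ r
_⊕_ = zipWith _xor_

Σv : ∀ {r} → List (F2^ r) → F2^ r
Σv = foldr _⊕_ 0v

Spans : ∀ {r} → (F2^ r → Set) → Set
Spans {r} E = (x : F2^ r) → Σ (List (F2^ r)) λ xs → All E xs × Σv xs ≡ x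

record BinObj : Set₁ where
  constructor mkObj
  field
    rank : ℕ
    E    : F2^ rank → Set

open BinObj public

-- A simple binary matroid: E ⊆ F₂^r ∖ {0} and E spans F₂^r.
record Matroid : Set₁ where
  field
    obj      : BinObj
    nonzero  : ∀ x → E obj x → ¬ (x ≡ 0v)
    spanning : Spans (E obj)

open Matroid public

-- Over F₂, a map is linear iff it is additive.
Linear : ∀ {r s} → (F2^ r → F2^ s) → Set
Linear f = ∀ x y → f (x ⊕ y) ≡ f x ⊕ f y

Contains : BinObj → BinObj → Set
Contains M N =
  Σ (F2^ (rank N) → F2^ (rank M)) λ ι →
    Linear ι × Injective _≡_ _≡_ ι × (∀ x → E N x → E M (ι x))

_at_ : (M : Matroid) → F2^ (rank (obj M)) → BinObj
M at v = mkObj (rank (obj M)) (λ x → E (obj M) x × E (obj M) (x ⊕ v))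

-- PG(s-1,2), as the object of rank s with all nonzero vectors (s is the rank).
PGrank : ℕ → BinObj
PGrank s = mkObj s (λ x → ¬ (x ≡ 0v))

-- A copy of PG(t-2,2) in M_v is an injective linear ι : F₂^{t-1} → F₂^r such that
-- both ι x and ι x + v lie in E(M) for every x ≠ 0. Adjoining v as a new basis vector,
-- (b, x) ↦ ι x + b v is linear; it is injective because v is not in the image of ι
-- (ι x = v would put 0 = ι x + v, or v = ι 0 = 0, into E(M)); and it sends every
-- nonzero vector into E(M): to ι x, to ι x + v, or to v itself.
module Submission where

open import Defs
open import Data.Nat using (ℕ; suc; _≤_; _∸_)
open import Data.Bool using (Bool; true; false; _xor_)
open import Data.Bool.Properties
  using (_≟_; xor-assoc; xor-comm; xor-identityˡ; xor-identityʳ; xor-same)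
open import Data.Vec using ([]; _∷_)
open import Data.Vec.Properties
  using (zipWith-assoc; zipWith-comm; zipWith-identityˡ; zipWith-identityʳ; ≡-dec)
open import Data.Product using (_,_; proj₁; proj₂)
open import Data.Empty using (⊥-elim)
open import Function.Definitions using (Injective)
open import Relation.Nullary using (¬_; yes; no)
open import Relation.Binary.PropositionalEquality
open ≡-Reasoning

module _ {r : ℕ} where

  ⊕-assoc : (x y z : F2^ r) → (x ⊕ y) ⊕ z ≡ x ⊕ (y ⊕ z)
  ⊕-assoc = zipWith-assoc xor-assoc

  ⊕-comm : (x y : F2^ r) → x ⊕ y ≡ y ⊕ x
  ⊕-comm = zipWith-comm xor-comm

  ⊕-identityˡ : (x : F2^ r) → 0v ⊕ x ≡ x
  ⊕-identityˡ = zipWith-identityˡ xor-identityˡ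

  ⊕-identityʳ : (x : F2^ r) → x ⊕ 0v ≡ x
  ⊕-identityʳ = zipWith-identityʳ xor-identityʳ

⊕-self : ∀ {r} (x : F2^ r) → x ⊕ x ≡ 0v
⊕-self []      = refl
⊕-self (b ∷ x) = cong₂ _∷_ (xor-same b) (⊕-self x)

⊕-interchange : ∀ {r} (w x y z : F2^ r) → (w ⊕ x) ⊕ (y ⊕ z) ≡ (w ⊕ y) ⊕ (x ⊕ z)
⊕-interchange w x y z = begin
  (w ⊕ x) ⊕ (y ⊕ z)  ≡⟨ ⊕-assoc w x (y ⊕ z) ⟩
  w ⊕ (x ⊕ (y ⊕ z))  ≡⟨ cong (w ⊕_) (sym (⊕-assoc x y z)) ⟩
  w ⊕ ((x ⊕ y) ⊕ z)  ≡⟨ cong (λ u → w ⊕ (u ⊕ z)) (⊕-comm x y) ⟩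
  w ⊕ ((y ⊕ x) ⊕ z)  ≡⟨ cong (w ⊕_) (⊕-assoc y x z) ⟩
  w ⊕ (y ⊕ (x ⊕ z))  ≡⟨ sym (⊕-assoc w y (x ⊕ z)) ⟩
  (w ⊕ y) ⊕ (x ⊕ z)  ∎

⊕≡0v⇒≡ : ∀ {r} (x y : F2^ r) → x ⊕ y ≡ 0v → x ≡ y
⊕≡0v⇒≡ x y x⊕y≡0 = begin
  x             ≡⟨ sym (⊕-identityʳ x) ⟩
  x ⊕ 0v        ≡⟨ cong (x ⊕_) (sym (⊕-self y)) ⟩
  x ⊕ (y ⊕ y)   ≡⟨ sym (⊕-assoc x y y) ⟩
  (x ⊕ y) ⊕ y   ≡⟨ cong (_⊕ y) x⊕y≡0 ⟩
  0v ⊕ y        ≡⟨ ⊕-identityˡ y ⟩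
  y             ∎

module _ {r s : ℕ} {f : F2^ r → F2^ s} (linear : Linear f) where

  Linear⇒0v↦0v : f 0v ≡ 0v
  Linear⇒0v↦0v = begin
    f 0v          ≡⟨ cong f (sym (⊕-self 0v)) ⟩
    f (0v ⊕ 0v)   ≡⟨ linear 0v 0v ⟩
    f 0v ⊕ f 0v   ≡⟨ ⊕-self (f 0v) ⟩
    0v            ∎

  trivialKernel⇒injective : (∀ x → f x ≡ 0v → x ≡ 0v) → Injective _≡_ _≡_ f
  trivialKernel⇒injective kernel {x} {y} fx≡fy = ⊕≡0v⇒≡ x y (kernel (x ⊕ y) (begin
    f (x ⊕ y)   ≡⟨ linear x y ⟩
    f x ⊕ f y   ≡⟨ cong (_⊕ f y) fx≡fy ⟩
    f y ⊕ f y   ≡⟨ ⊕-self (f y) ⟩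
    0v          ∎))

scale : ∀ {r} → Bool → F2^ r → F2^ r
scale true  v = v
scale false _ = 0v

scale-xor : ∀ {r} b c (v : F2^ r) → scale (b xor c) v ≡ scale b v ⊕ scale c v
scale-xor true  true  v = sym (⊕-self v)
scale-xor true  false v = sym (⊕-identityʳ v)
scale-xor false c     v = sym (⊕-identityˡ (scale c v))

extend : ∀ {t r} → (F2^ t → F2^ r) → F2^ r → F2^ (suc t) → F2^ r
extend ι v (b ∷ x) = ι x ⊕ scale b v

module _ {t r : ℕ} {ι : F2^ t → F2^ r} (linear : Linear ι) (v : F2^ r) where

  extend-linear : Linear (extend ι v)
  extend-linear (b ∷ x) (c ∷ y) = begin
    ι (x ⊕ y) ⊕ scale (b xor c) v        ≡⟨ cong₂ _⊕_ (linear x y) (scale-xor b c v) ⟩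
    (ι x ⊕ ι y) ⊕ (scale b v ⊕ scale c v) ≡⟨ ⊕-interchange (ι x) (ι y) (scale b v) (scale c v) ⟩
    (ι x ⊕ scale b v) ⊕ (ι y ⊕ scale c v) ∎

  extend-injective : Injective _≡_ _≡_ ι → (∀ x → ¬ ι x ≡ v) → Injective _≡_ _≡_ (extend ι v)
  extend-injective injective v∉imι = trivialKernel⇒injective extend-linear kernel
    where
    kernel : ∀ z → extend ι v z ≡ 0v → z ≡ 0v
    kernel (false ∷ x) ιx⊕0≡0 = cong (false ∷_) (injective (begin
      ι x        ≡⟨ sym (⊕-identityʳ (ι x)) ⟩
      ι x ⊕ 0v   ≡⟨ ιx⊕0≡0 ⟩
      0v         ≡⟨ sym (Linear⇒0v↦0v linear) ⟩
      ι 0v       ∎))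
    kernel (true ∷ x) ιx⊕v≡0 = ⊥-elim (v∉imι x (⊕≡0v⇒≡ (ι x) v ιx⊕v≡0))

module _ (M : Matroid) {v : F2^ (rank (obj M))} (v∈E : E (obj M) v)
         {t : ℕ} {ι : F2^ t → F2^ (rank (obj M))} (linear : Linear ι)
         (ι-PG : ∀ x → ¬ x ≡ 0v → E (M at v) (ι x)) where

  ι0v≡0v : ι 0v ≡ 0v
  ι0v≡0v = Linear⇒0v↦0v linear

  v∉imι : ∀ x → ¬ ι x ≡ v
  v∉imι x ιx≡v with ≡-dec _≟_ x 0v
  ... | yes refl = nonzero M v v∈E (trans (sym ιx≡v) ι0v≡0v)
  ... | no  x≢0  = nonzero M (ι x ⊕ v) (proj₂ (ι-PG x x≢0))
                     (trans (cong (_⊕ v) ιx≡v) (⊕-self v))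

  extend-PG : ∀ z → ¬ z ≡ 0v → E (obj M) (extend ι v z)
  extend-PG (false ∷ x) z≢0 = subst (E (obj M)) (sym (⊕-identityʳ (ι x)))
    (proj₁ (ι-PG x (λ x≡0 → z≢0 (cong (false ∷_) x≡0))))
  extend-PG (true ∷ x) z≢0 with ≡-dec _≟_ x 0v
  ... | yes refl = subst (E (obj M)) (sym (trans (cong (_⊕ v) ι0v≡0v) (⊕-identityˡ v))) v∈E
  ... | no  x≢0  = proj₂ (ι-PG x x≢0)

Contains-PG-at⇒Contains-PG-suc : (M : Matroid) (v : F2^ (rank (obj M))) → E (obj M) v →
  ∀ t → Contains (M at v) (PGrank t) → Contains (obj M) (PGrank (suc t))
Contains-PG-at⇒Contains-PG-suc M v v∈E t (ι , linear , injective , ι-PG) =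
  extend ι v ,
  extend-linear linear v ,
  extend-injective linear v injective (v∉imι M v∈E linear ι-PG) ,
  extend-PG M v∈E linear ι-PG

proposition2p5 : (t : ℕ) → 3 ≤ t → (M : Matroid) → (v : F2^ (rank (obj M))) →
    E (obj M) v → Contains (M at v) (PGrank (t ∸ 1)) → Contains (obj M) (PGrank t)
proposition2p5 (suc t) _ M v v∈E = Contains-PG-at⇒Contains-PG-suc M v v∈E t
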